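{- Let $G$ be a connected non-complete finite simple graph with maximum degree $\Delta$, and let $f:V(G)\to[\Delta]$ be any proper vertex coloring. Then there is a proper half-edge coloring $h:E(G^{\frac{1}{2}})\to[\Delta]$ such that $f$ and $h$ are $2$-incompatible.
   Context: $[k]=\{1,\dots,k\}$. $G^{\frac{1}{2}}$ is obtained from $G$ by subdividing each edge once; each edge $uv$ of $G$ gives two edges of $G^{\frac{1}{2}}$ (half-edges) $e_{uv}$, incident with $u$, and $e_{vu}$, incident with $v$. A proper half-edge coloring is a proper edge coloring of $G^{\frac{1}{2}}$. Given $f$ and $h$, a half-edge $e_{uv}$ is incompatible if $h(e_{uv})=f(v)$, and compatible otherwise. $f$ and $h$ are $k$-incompatible if every vertex $u$ of $G$ has at most $k$ incompatible half-edges $e_{uv}$ ($v\in N_G(u)$). -}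

module Defs where

open import Data.Nat using (ℕ; zero; suc; _≤_)
open import Data.Fin using (Fin)
open import Data.Bool using (Bool; true; false; T; if_then_else_)
open import Data.Product using (Σ; _×_; _,_; ∃)
open import Data.List using (List; []; _∷_; length; filter)
open import Data.List using (allFin)
open import Relation.Nullary using (¬_; Dec; yes; no; does)
open import Data.Bool.Properties using (T?)
open import Relation.Binary.PropositionalEquality using (_≡_; _≢_)
open import Data.Fin using (_≟_)

record Graph (n : ℕ) : Set where
  field
    adj   : Fin n → Fin n → Bool
    sym   : ∀ u v → adj u v ≡ adj v u
    irrefl : ∀ u → adj u u ≡ false
open Graph public

Adj : ∀ {n} → Graph n → Fin n → Fin n → Set
Adj G u v = T (adj G u v)

count : ∀ {n} → (Fin n → Bool) → ℕ
count {n} p = length (filter (λ i → Data.Bool._≟_ (p i) true) (allFin n))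

degree : ∀ {n} → Graph n → Fin n → ℕ
degree G u = count (adj G u)

IsMaxDegree : ∀ {n} → Graph n → ℕ → Set
IsMaxDegree G Δ = (∀ u → degree G u ≤ Δ) × (∃ λ u → degree G u ≡ Δ)

data Walk {n} (G : Graph n) : Fin n → Fin n → Set where
  here : ∀ {u} → Walk G u u
  step : ∀ {u v w} → Adj G u v → Walk G v w → Walk G u w

Connected : ∀ {n} → Graph n → Set
Connected G = ∀ u v → Walk G u v

NonComplete : ∀ {n} → Graph n → Set
NonComplete G = Σ _ λ u → Σ _ λ v → u ≢ v × ¬ Adj G u v

ProperVertexColoring : ∀ {n} → Graph n → (k : ℕ) → (Fin n → Fin k) → Set
ProperVertexColoring G k f = ∀ u v → Adj G u v → f u ≢ f v

-- a half-edge colouring: h u v _ is the colour of the half-edge e_uv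
-- (the half of edge uv incident with u)
HalfEdgeColoring : ∀ {n} → Graph n → ℕ → Set
HalfEdgeColoring G k = ∀ u v → Adj G u v → Fin k

-- proper edge colouring of G^{1/2}: two half-edges are adjacent in G^{1/2}
-- iff they share u (e_uv, e_uw with v ≠ w) or they are e_uv, e_vu
-- (sharing the subdivision vertex of uv).
ProperHalfEdgeColoring : ∀ {n} (G : Graph n) (k : ℕ) → HalfEdgeColoring G k → Set
ProperHalfEdgeColoring G k h =
  (∀ u v w (a : Adj G u v) (b : Adj G u w) → v ≢ w → h u v a ≢ h u w b) ×
  (∀ u v (a : Adj G u v) (b : Adj G v u) → h u v a ≢ h v u b)

incompatible? : ∀ {n k} (G : Graph n) → (Fin n → Fin k) → HalfEdgeColoring G k →
                Fin n → Fin n → Bool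
incompatible? G f h u v with T? (adj G u v)
... | no _ = false
... | yes a = does (h u v a ≟ f v)

incompatibleCount : ∀ {n k} (G : Graph n) → (Fin n → Fin k) → HalfEdgeColoring G k →
                    Fin n → ℕ
incompatibleCount G f h u = count (incompatible? G f h u)

Incompatible : ∀ {n k} (G : Graph n) → (Fin n → Fin k) → HalfEdgeColoring G k → ℕ → Set
Incompatible G f h j = ∀ u → incompatibleCount G f h u ≤ j

module Submission where

-- For Δ ≤ 1 the hypotheses are contradictory: a non-complete graph
-- has a vertex, so Δ ≠ 0, and with a single colour a proper vertex colouring
-- forbids every edge, so a connected graph has no two distinct vertices.  For
-- Δ ≥ 2 the conclusion holds for every graph of maximum degree at most Δ and
-- every f : V → [Δ].
--
-- A half-edge colouring is stored as a matrix H, H u v being the colour of e_uv.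
-- Row u is good if it is injective on the neighbours of u and H u v = f v for at
-- most two neighbours v.  The global construction
-- (module Construction) gives rows to the vertices in index order, each new vertex
-- r avoiding the colours H w r placed by processed neighbours w.  If r is blocked,
-- the matrix is repaired along a chain: a neighbour y of r re-chooses its row
-- avoiding c towards r; if y is blocked too, all its other neighbours send c to y
-- and we recurse at one of them.  The chain never revisits a vertex, so it stops,
-- and afterwards r sees two different demands.

open import Defs hiding (sym)
open import Data.Nat using (ℕ; zero; suc; _+_; _≤_; _<_; z≤n; s≤s; _<?_)
open import Data.Nat.Properties
  using (≤-trans; ≤-refl; ≤-reflexive; n≤1+n; <⇒≤; 1+n≰n; ≮⇒≥; +-suc; m≤m+n; m<1+n⇒m<n∨m≡n)
open import Data.Fin using (Fin; zero; suc; _≟_; toℕ; fromℕ<)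
open import Data.Fin.Properties using (¬Fin0; ¬∀⟶∃¬; injective⇒≤; toℕ<n; toℕ-fromℕ<; toℕ-injective)
open import Data.Vec.Functional using (updateAt)
open import Data.Vec.Functional.Properties using (updateAt-updates; updateAt-minimal)
open import Data.List using (List; []; _∷_; length; lookup; filter; map; allFin)
open import Data.List.Properties using (length-map; filter-notAll)
open import Data.List.Membership.Propositional using (_∈_; _∉_; find)
open import Data.List.Membership.Propositional.Properties
  using (∈-filter⁺; ∈-filter⁻; ∈-allFin; ∈-map⁺; ∈-lookup)
open import Data.List.Relation.Binary.Subset.Propositional using (_⊆_)
open import Data.List.Relation.Unary.Any using (here; there; index; any?)
import Data.List.Relation.Unary.Any as Any
open import Data.List.Relation.Unary.Any.Properties using (lookup-index)
open import Data.List.Relation.Unary.All using (All; []; _∷_; all?)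
import Data.List.Relation.Unary.All as All
open import Data.List.Relation.Unary.All.Properties using (All¬⇒¬Any; ¬Any⇒All¬; ¬All⇒Any¬)
open import Data.List.Relation.Unary.AllPairs using ([]; _∷_)
open import Data.List.Relation.Unary.Unique.Propositional using (Unique)
open import Data.List.Relation.Unary.Unique.Propositional.Properties using (allFin⁺; filter⁺)
open import Data.Maybe using (Maybe; nothing; just)
open import Data.Maybe.Properties using (just-injective)
import Data.Maybe.Properties as Maybe
open import Data.Product using (Σ; ∃; ∃₂; _×_; _,_; proj₁; proj₂)
open import Data.Sum using (_⊎_; inj₁; inj₂; [_,_]′)
import Data.Sum as Sum
open import Data.Empty using (⊥; ⊥-elim)
open import Data.Bool using (true; T)
import Data.Bool as Bool
open import Data.Bool.Properties using (T-≡; T?)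
open import Function using (_∘_; const)
open import Function.Bundles using (Equivalence)
open import Relation.Nullary using (¬_; yes; no; ¬?)
open import Relation.Binary.PropositionalEquality
  using (_≡_; _≢_; refl; sym; trans; cong; cong-app; subst; _≗_)

_[_≔_] : ∀ {A : Set} {n} → (Fin n → A) → Fin n → A → Fin n → A
g [ x ≔ a ] = updateAt g x (const a)

≔-same : ∀ {A : Set} {n} (g : Fin n → A) x a → (g [ x ≔ a ]) x ≡ a
≔-same g x a = updateAt-updates x g

≔-other : ∀ {A : Set} {n} (g : Fin n → A) {x} a {v} → v ≢ x → (g [ x ≔ a ]) v ≡ g v
≔-other g {x} a {v} = updateAt-minimal v x g

≔-outside : ∀ {A : Set} {n} (g : Fin n → A) {x} a {v R} → x ∉ R → v ∈ R → (g [ x ≔ a ]) v ≡ g v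
≔-outside g a x∉R v∈R = ≔-other g a λ { refl → x∉R v∈R }

head∉tail : ∀ {A : Set} {x : A} {xs} → Unique (x ∷ xs) → x ∉ xs
head∉tail (x≢xs ∷ _) = All¬⇒¬Any x≢xs

lookup-injective : ∀ {A : Set} {xs : List A} → Unique xs → ∀ i j → lookup xs i ≡ lookup xs j → i ≡ j
lookup-injective {xs = _ ∷ _} _          zero    zero    _  = refl
lookup-injective {xs = _ ∷ _} (x≢xs ∷ _) zero    (suc j) x≡ = ⊥-elim (All.lookup x≢xs (∈-lookup j) x≡)
lookup-injective {xs = _ ∷ _} (x≢xs ∷ _) (suc i) zero    ≡x = ⊥-elim (All.lookup x≢xs (∈-lookup i) (sym ≡x))
lookup-injective {xs = _ ∷ _} (_ ∷ u)    (suc i) (suc j) eq = cong suc (lookup-injective u i j eq)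

unique-length≤ : ∀ {m} {xs : List (Fin m)} → Unique xs → length xs ≤ m
unique-length≤ u = injective⇒≤ (λ {i} {j} → lookup-injective u i j)

fresh : ∀ {m} (xs : List (Fin m)) → length xs < m → ∃ λ c → c ∉ xs
fresh {m} xs short = ¬∀⟶∃¬ m (_∈ xs) (λ c → any? (c ≟_) xs) notAll
  where
  notAll : ¬ (∀ c → c ∈ xs)
  notAll all = 1+n≰n (≤-trans short (injective⇒≤ index-injective))
    where
    index-injective : ∀ {c d} → index (all c) ≡ index (all d) → c ≡ d
    index-injective {c} {d} eq =
      trans (lookup-index (all c)) (trans (cong (lookup xs) eq) (sym (lookup-index (all d))))

AtMostTwo : ∀ {A : Set} → (A → Set) → Set
AtMostTwo P = ∀ {u v w} → P u → P v → P w → u ≢ v → u ≢ w → v ≢ w → ⊥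

atMostTwo : ∀ {A : Set} {P : A → Set} (t₁ t₂ : A) → (∀ {v} → P v → v ≡ t₁ ⊎ v ≡ t₂) → AtMostTwo P
atMostTwo t₁ t₂ within pu pv pw u≢v u≢w v≢w with within pu | within pv | within pw
... | inj₁ refl | inj₁ refl | _         = u≢v refl
... | inj₁ refl | inj₂ refl | inj₁ refl = u≢w refl
... | inj₁ refl | inj₂ refl | inj₂ refl = v≢w refl
... | inj₂ refl | inj₁ refl | inj₁ refl = v≢w refl
... | inj₂ refl | inj₁ refl | inj₂ refl = u≢w refl
... | inj₂ refl | inj₂ refl | _         = u≢v refl

unique-length≤2 : ∀ {A : Set} {P : A → Set} {xs} → Unique xs → All P xs → AtMostTwo P → length xs ≤ 2
unique-length≤2 {xs = []}                _ _ _ = z≤n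
unique-length≤2 {xs = _ ∷ []}            _ _ _ = s≤s z≤n
unique-length≤2 {xs = _ ∷ _ ∷ []}        _ _ _ = s≤s (s≤s z≤n)
unique-length≤2 {xs = _ ∷ _ ∷ _ ∷ _} ((x≢y ∷ x≢z ∷ _) ∷ (y≢z ∷ _) ∷ _) (px ∷ py ∷ pz ∷ _) two =
  ⊥-elim (two px py pz x≢y x≢z y≢z)

twoDistinct : ∀ {A : Set} {xs : List A} → Unique xs → 2 ≤ length xs →
              ∃₂ λ a b → a ∈ xs × b ∈ xs × a ≢ b
twoDistinct {xs = a ∷ b ∷ _} ((a≢b ∷ _) ∷ _) _ = a , b , here refl , there (here refl) , a≢b
twoDistinct {xs = _ ∷ []}    _              (s≤s ())

-- Demands F : Fin n → Maybe (Fin Δ)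
-- name, for some members v, a colour that φ v must avoid.
module Rows {n Δ : ℕ} (s : Fin n → Fin Δ) where

  InjectiveOn : List (Fin n) → (Fin n → Fin Δ) → Set
  InjectiveOn xs φ = ∀ {v w} → v ∈ xs → w ∈ xs → v ≢ w → φ v ≢ φ w

  GoodRow : List (Fin n) → (Fin n → Fin Δ) → Set
  GoodRow xs φ = InjectiveOn xs φ × AtMostTwo (λ v → v ∈ xs × φ v ≡ s v)

  Respects : (Fin n → Maybe (Fin Δ)) → List (Fin n) → (Fin n → Fin Δ) → Set
  Respects F xs φ = ∀ {v} → v ∈ xs → F v ≢ just (φ v)

  Solution : (Fin n → Maybe (Fin Δ)) → List (Fin n) → (Fin n → Fin Δ) → Set
  Solution F xs φ = GoodRow xs φ × Respects F xs φ

  -- Sufficient conditions for a solution: a spare colour, an undemanding member,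
  -- or two members with different demands.
  Unblocked : (Fin n → Maybe (Fin Δ)) → List (Fin n) → Set
  Unblocked F xs = length xs < Δ ⊎ (∃ λ v → v ∈ xs × F v ≡ nothing) ⊎
                   (∃₂ λ v w → v ∈ xs × w ∈ xs × F v ≢ F w)

  Blocked : (Fin n → Maybe (Fin Δ)) → List (Fin n) → Set
  Blocked F xs = Δ ≤ length xs × ∃ λ c → All (λ v → F v ≡ just c) xs

  unblocked? : 1 ≤ Δ → ∀ F xs → Unblocked F xs ⊎ Blocked F xs
  unblocked? 1≤Δ F [] = inj₁ (inj₁ 1≤Δ)
  unblocked? _ F xs@(x ∷ _) with length xs <? Δ | F x in Fx
  ... | yes short | _       = inj₁ (inj₁ short)
  ... | no _      | nothing = inj₁ (inj₂ (inj₁ (x , here refl , Fx)))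
  ... | no long   | just c with all? (λ v → Maybe.≡-dec _≟_ (F v) (just c)) xs
  ...   | yes same = inj₂ (≮⇒≥ long , c , same)
  ...   | no ¬same =
          let v , v∈ , Fv≢c = find (¬All⇒Any¬ (λ v → Maybe.≡-dec _≟_ (F v) (just c)) xs ¬same)
          in inj₁ (inj₂ (inj₂ (v , x , v∈ , here refl , λ Fv≡Fx → Fv≢c (trans Fv≡Fx Fx))))

  solution-⊆ : ∀ {F xs ys φ} → xs ⊆ ys → Solution F ys φ → Solution F xs φ
  solution-⊆ xs⊆ys ((injective , fewSoft) , respects) =
    ((λ v∈ w∈ → injective (xs⊆ys v∈) (xs⊆ys w∈)) ,
     (λ (u∈ , pu) (v∈ , pv) (w∈ , pw) → fewSoft (xs⊆ys u∈ , pu) (xs⊆ys v∈ , pv) (xs⊆ys w∈ , pw))) ,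
    respects ∘ xs⊆ys

  unused : ∀ {R} {ψ : Fin n → Fin Δ} {c v} → c ∉ map ψ R → v ∈ R → ψ v ≢ c
  unused {R} {ψ} c∉ v∈ ψv≡c = c∉ (subst (_∈ map ψ R) ψv≡c (∈-map⁺ ψ v∈))

  extend-injective : ∀ {R φ x c} → InjectiveOn R φ → x ∉ R → (∀ {v} → v ∈ R → φ v ≢ c) →
                     InjectiveOn (x ∷ R) (φ [ x ≔ c ])
  extend-injective {R} {φ} {x} {c} injective x∉R unused-c = go
    where
    kept : ∀ {v} → v ∈ R → (φ [ x ≔ c ]) v ≡ φ v
    kept = ≔-outside φ c x∉R
    go : InjectiveOn (x ∷ R) (φ [ x ≔ c ])
    go (here refl) (here refl) v≢w   = ⊥-elim (v≢w refl)
    go (here refl) (there w∈)  _   eq = unused-c w∈ (trans (sym (kept w∈)) (trans (sym eq) (≔-same φ x c)))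
    go (there v∈)  (here refl) _   eq = unused-c v∈ (trans (sym (kept v∈)) (trans eq (≔-same φ x c)))
    go (there v∈)  (there w∈)  v≢w eq = injective v∈ w∈ v≢w (trans (sym (kept v∈)) (trans eq (kept w∈)))

  _─_ : List (Fin n) → Fin n → List (Fin n)
  xs ─ t = filter (λ v → ¬? (v ≟ t)) xs

  ─-unique : ∀ {xs} t → Unique xs → Unique (xs ─ t)
  ─-unique t = filter⁺ (λ v → ¬? (v ≟ t))

  ─-removes : ∀ xs t → t ∉ xs ─ t
  ─-removes xs t t∈ = proj₂ (∈-filter⁻ (λ v → ¬? (v ≟ t)) {xs = xs} t∈) refl

  ─-⊆ : ∀ xs t → xs ─ t ⊆ xs
  ─-⊆ xs t v∈ = proj₁ (∈-filter⁻ (λ v → ¬? (v ≟ t)) {xs = xs} v∈)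

  ─-keeps : ∀ {xs t v} → v ∈ xs → v ≢ t → v ∈ xs ─ t
  ─-keeps {t = t} = ∈-filter⁺ (λ v → ¬? (v ≟ t))

  ─-shorter : ∀ {xs t} → t ∈ xs → length (xs ─ t) < length xs
  ─-shorter {xs} {t} t∈ =
    filter-notAll (λ v → ¬? (v ≟ t)) xs (Any.map (λ t≡v v≢t → v≢t (sym t≡v)) t∈)

  -- All members but two "tails"
  -- t₁, t₂ are coloured greedily, avoiding demands and soft colours; the tails
  -- get two remaining colours avoiding their demands only.
  module Solve (2≤Δ : 2 ≤ Δ) (F : Fin n → Maybe (Fin Δ)) where

    avoid : ∀ (m : Maybe (Fin Δ)) I → 2 + length I ≤ Δ → ∃ λ c → c ∉ I × m ≢ just c
    avoid nothing I room =
      let c , c∉I = fresh I (≤-trans (n≤1+n _) room) in c , c∉I , λ ()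
    avoid (just a) I room =
      let c , c∉ = fresh (a ∷ I) room in c , c∉ ∘ there , λ a≡c → c∉ (here (sym (just-injective a≡c)))

    TwoColours : List (Fin Δ) → Maybe (Fin Δ) → Maybe (Fin Δ) → Set
    TwoColours I m₁ m₂ = ∃₂ λ c₁ c₂ → c₁ ∉ I × c₂ ∉ I × c₁ ≢ c₂ × m₁ ≢ just c₁ × m₂ ≢ just c₂

    swapColours : ∀ {I m₁ m₂} → TwoColours I m₂ m₁ → TwoColours I m₁ m₂
    swapColours (c₂ , c₁ , c₂∉ , c₁∉ , c₂≢c₁ , ok₂ , ok₁) = c₁ , c₂ , c₁∉ , c₂∉ , c₂≢c₁ ∘ sym , ok₁ , ok₂

    -- Choosing c₁ first and then c₂ needs a third spare colour ...
    inOrder : ∀ I m₁ m₂ → 3 + length I ≤ Δ → TwoColours I m₁ m₂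
    inOrder I m₁ m₂ room =
      let c₁ , c₁∉ , ok₁ = avoid m₁ I (≤-trans (n≤1+n _) room)
          c₂ , c₂∉ , ok₂ = avoid m₂ (c₁ ∷ I) room
      in c₁ , c₂ , c₁∉ , c₂∉ ∘ there , (λ c₁≡c₂ → c₂∉ (here (sym c₁≡c₂))) , ok₁ , ok₂

    -- ... unless the second tail demands nothing.
    inOrderFree : ∀ I m₁ → 2 + length I ≤ Δ → TwoColours I m₁ nothing
    inOrderFree I m₁ room =
      let c₁ , c₁∉ , ok₁ = avoid m₁ I room
          c₂ , c₂∉ = fresh (c₁ ∷ I) room
      in c₁ , c₂ , c₁∉ , c₂∉ ∘ there , (λ c₁≡c₂ → c₂∉ (here (sym c₁≡c₂))) , ok₁ , λ ()

    twoSpare : ∀ I → 2 + length I ≤ Δ → ∃₂ λ p q → p ∉ I × q ∉ I × p ≢ q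
    twoSpare I room =
      let p , p∉ = fresh I (≤-trans (n≤1+n _) room)
          q , q∉ = fresh (p ∷ I) room
      in p , q , p∉ , q∉ ∘ there , λ p≡q → q∉ (here (sym p≡q))

    -- Two distinct spare colours p, q can be matched to two different demands a, b:
    -- if (p, q) clashes with (a, b) then (q, p) does not.
    matchDemands : ∀ {I p q a b} → p ∉ I → q ∉ I → p ≢ q → just a ≢ just b →
                   TwoColours I (just a) (just b)
    matchDemands {p = p} {q} {a} {b} p∉ q∉ p≢q a≢b with p ≟ a | q ≟ b
    ... | no p≢a   | no q≢b   = p , q , p∉ , q∉ , p≢q ,
                                 (λ e → p≢a (sym (just-injective e))) , (λ e → q≢b (sym (just-injective e)))
    ... | yes refl | _        = q , p , q∉ , p∉ , p≢q ∘ sym , (λ e → p≢q (just-injective e)) , a≢b ∘ sym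
    ... | no _     | yes refl = q , p , q∉ , p∉ , p≢q ∘ sym , a≢b , (λ e → p≢q (sym (just-injective e)))

    twoColours : ∀ I m₁ m₂ → 2 + length I ≤ Δ → 3 + length I ≤ Δ ⊎ m₂ ≡ nothing ⊎ m₁ ≢ m₂ →
                 TwoColours I m₁ m₂
    twoColours I m₁ m₂       _    (inj₁ room₃)           = inOrder I m₁ m₂ room₃
    twoColours I m₁ .nothing room (inj₂ (inj₁ refl))     = inOrderFree I m₁ room
    twoColours I nothing m₂  room (inj₂ (inj₂ _))        = swapColours (inOrderFree I m₂ room)
    twoColours I (just a) nothing room (inj₂ (inj₂ _))   = inOrderFree I (just a) room
    twoColours I (just a) (just b) room (inj₂ (inj₂ a≢b)) =
      let p , q , p∉ , q∉ , p≢q = twoSpare I room in matchDemands p∉ q∉ p≢q a≢b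

    Greedy : List (Fin n) → (Fin n → Fin Δ) → Set
    Greedy R ψ = InjectiveOn R ψ × (∀ {v} → v ∈ R → F v ≢ just (ψ v) × ψ v ≢ s v)

    -- It exists when two colours are to spare: each vertex avoids the colours
    -- used so far, its demand and its soft colour.
    greedy : ∀ R → Unique R → 2 + length R ≤ Δ → ∃ (Greedy R)
    greedy [] _ _ = s , (λ ()) , λ ()
    greedy (x ∷ R) u@(_ ∷ uR) room = addHead (greedy R uR (≤-trans (n≤1+n _) room))
      where
      x∉R = head∉tail u
      addHead : ∃ (Greedy R) → ∃ (Greedy (x ∷ R))
      addHead (ψ , injective , ok) = ψ [ x ≔ c ] , extend-injective injective x∉R (unused (c∉ ∘ there)) , ok′
        where
        room′ : 2 + length (s x ∷ map ψ R) ≤ Δ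
        room′ = subst (λ k → 3 + k ≤ Δ) (sym (length-map ψ R)) room
        picked = avoid (F x) (s x ∷ map ψ R) room′
        c = proj₁ picked
        c∉ = proj₁ (proj₂ picked)
        ok′ : ∀ {v} → v ∈ x ∷ R → F v ≢ just ((ψ [ x ≔ c ]) v) × (ψ [ x ≔ c ]) v ≢ s v
        ok′ {v} (here refl) =
          subst (λ z → F v ≢ just z × z ≢ s v) (sym (≔-same ψ x c)) (proj₂ (proj₂ picked) , c∉ ∘ here)
        ok′ {v} (there v∈) = subst (λ z → F v ≢ just z × z ≢ s v) (sym (≔-outside ψ c x∉R v∈)) (ok v∈)

    -- Extending a greedy colouring ψ of R by two distinct unused colours c₁, c₂ at
    -- the tails t₁, t₂ gives a solution; soft violations occur only at the tails.
    assemble : ∀ {t₁ t₂ R ψ c₁ c₂} → t₁ ∉ R → t₂ ∉ R → t₁ ≢ t₂ → Greedy R ψ →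
               c₁ ∉ map ψ R → c₂ ∉ map ψ R → c₁ ≢ c₂ → F t₁ ≢ just c₁ → F t₂ ≢ just c₂ →
               Solution F (t₁ ∷ t₂ ∷ R) ((ψ [ t₂ ≔ c₂ ]) [ t₁ ≔ c₁ ])
    assemble {t₁} {t₂} {R} {ψ} {c₁} {c₂} t₁∉R t₂∉R t₁≢t₂ (injectiveψ , okψ) c₁∉ c₂∉ c₁≢c₂ ok₁ ok₂ =
      (injective , atMostTwo t₁ t₂ soft) , respects
      where
      φ₂ = ψ [ t₂ ≔ c₂ ]
      φ = φ₂ [ t₁ ≔ c₁ ]
      φ₂-on-R : ∀ {v} → v ∈ R → φ₂ v ≡ ψ v
      φ₂-on-R = ≔-outside ψ c₂ t₂∉R
      value : ∀ {v} → v ∈ t₁ ∷ t₂ ∷ R →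
              (v ≡ t₁ × φ v ≡ c₁) ⊎ (v ≡ t₂ × φ v ≡ c₂) ⊎ (v ∈ R × φ v ≡ ψ v)
      value (here refl)         = inj₁ (refl , ≔-same φ₂ t₁ c₁)
      value (there (here refl)) = inj₂ (inj₁ (refl , trans (≔-other φ₂ c₁ (t₁≢t₂ ∘ sym)) (≔-same ψ t₂ c₂)))
      value (there (there v∈))  = inj₂ (inj₂ (v∈ , trans (≔-outside φ₂ c₁ t₁∉R v∈) (φ₂-on-R v∈)))
      injective : InjectiveOn (t₁ ∷ t₂ ∷ R) φ
      injective = extend-injective (extend-injective injectiveψ t₂∉R (unused c₂∉))
                    (λ { (here t₁≡t₂) → t₁≢t₂ t₁≡t₂ ; (there t₁∈R) → t₁∉R t₁∈R })
                    (λ { (here refl) φ₂t₂≡c₁ → c₁≢c₂ (trans (sym φ₂t₂≡c₁) (≔-same ψ t₂ c₂))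
                       ; (there v∈)  φ₂v≡c₁  → unused c₁∉ v∈ (trans (sym (φ₂-on-R v∈)) φ₂v≡c₁) })
      soft : ∀ {v} → v ∈ t₁ ∷ t₂ ∷ R × φ v ≡ s v → v ≡ t₁ ⊎ v ≡ t₂
      soft (v∈ , φv≡sv) with value v∈
      ... | inj₁ (v≡t₁ , _)           = inj₁ v≡t₁
      ... | inj₂ (inj₁ (v≡t₂ , _))    = inj₂ v≡t₂
      ... | inj₂ (inj₂ (v∈R , φv≡ψv)) = ⊥-elim (proj₂ (okψ v∈R) (trans (sym φv≡ψv) φv≡sv))
      respects : Respects F (t₁ ∷ t₂ ∷ R) φ
      respects {v} v∈ with value v∈
      ... | inj₁ (refl , φv≡c₁)        = subst (λ z → F v ≢ just z) (sym φv≡c₁) ok₁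
      ... | inj₂ (inj₁ (refl , φv≡c₂)) = subst (λ z → F v ≢ just z) (sym φv≡c₂) ok₂
      ... | inj₂ (inj₂ (v∈R , φv≡ψv))  = subst (λ z → F v ≢ just z) (sym φv≡ψv) (proj₁ (okψ v∈R))

    viaTails : ∀ {t₁ t₂ R} → Unique R → t₁ ∉ R → t₂ ∉ R → t₁ ≢ t₂ → 2 + length R ≤ Δ →
               3 + length R ≤ Δ ⊎ F t₂ ≡ nothing ⊎ F t₁ ≢ F t₂ → ∃ (Solution F (t₁ ∷ t₂ ∷ R))
    viaTails {t₁} {t₂} {R} uR t₁∉R t₂∉R t₁≢t₂ room cond =
      let ψ , greedyψ = greedy R uR room
          |I|≡|R| = length-map ψ R
          c₁ , c₂ , c₁∉ , c₂∉ , c₁≢c₂ , ok₁ , ok₂ =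
            twoColours (map ψ R) (F t₁) (F t₂) (subst (λ k → 2 + k ≤ Δ) (sym |I|≡|R|) room)
                       (Sum.map₁ (subst (λ k → 3 + k ≤ Δ) (sym |I|≡|R|)) cond)
      in _ , assemble t₁∉R t₂∉R t₁≢t₂ greedyψ c₁∉ c₂∉ c₁≢c₂ ok₁ ok₂

    withTails : ∀ {xs t₁ t₂} → Unique xs → length xs ≤ Δ → t₁ ∈ xs → t₂ ∈ xs → t₁ ≢ t₂ →
                length xs < Δ ⊎ F t₂ ≡ nothing ⊎ F t₁ ≢ F t₂ → ∃ (Solution F xs)
    withTails {xs} {t₁} {t₂} u fits t₁∈ t₂∈ t₁≢t₂ cond =
      let φ , solution = viaTails (─-unique t₁ (─-unique t₂ u)) (─-removes (xs ─ t₂) t₁) t₂∉R t₁≢t₂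
                                  (≤-trans shorter fits) (Sum.map₁ (≤-trans (s≤s shorter)) cond)
      in φ , solution-⊆ covered solution
      where
      R = (xs ─ t₂) ─ t₁
      shorter : 2 + length R ≤ length xs
      shorter = ≤-trans (s≤s (─-shorter (─-keeps t₁∈ t₁≢t₂))) (─-shorter t₂∈)
      t₂∉R : t₂ ∉ R
      t₂∉R t₂∈R = ─-removes xs t₂ (─-⊆ (xs ─ t₂) t₁ t₂∈R)
      covered : xs ⊆ t₁ ∷ t₂ ∷ R
      covered {v} v∈ with v ≟ t₁ | v ≟ t₂
      ... | yes v≡t₁ | _        = here v≡t₁
      ... | no _     | yes v≡t₂ = there (here v≡t₂)
      ... | no v≢t₁  | no v≢t₂  = there (there (─-keeps (─-keeps v∈ v≢t₂) v≢t₁))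

    solve : ∀ xs → Unique xs → length xs ≤ Δ → Unblocked F xs → ∃ (Solution F xs)
    solve [] _ _ _ = s , ((λ ()) , λ { (() , _) }) , λ ()
    solve (t ∷ []) _ _ _ =
      const c , ((λ v∈ w∈ v≢w _ → v≢w (trans (single v∈) (sym (single w∈)))) ,
                 atMostTwo t t (inj₁ ∘ single ∘ proj₁)) ,
      λ v∈ → subst (λ v → F v ≢ just c) (sym (single v∈)) ok
      where
      single : ∀ {v} → v ∈ t ∷ [] → v ≡ t
      single (here v≡t) = v≡t
      picked = avoid (F t) [] 2≤Δ
      c = proj₁ picked
      ok = proj₂ (proj₂ picked)
    solve (x₁ ∷ x₂ ∷ _) u@((x₁≢x₂ ∷ _) ∷ _) fits (inj₁ short) =
      withTails u fits (here refl) (there (here refl)) x₁≢x₂ (inj₁ short)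
    solve (x₁ ∷ x₂ ∷ _) u@((x₁≢x₂ ∷ _) ∷ _) fits (inj₂ (inj₁ (v , v∈ , Fv≡nothing))) with x₁ ≟ v
    ... | yes refl = withTails u fits (there (here refl)) v∈ (x₁≢x₂ ∘ sym) (inj₂ (inj₁ Fv≡nothing))
    ... | no x₁≢v  = withTails u fits (here refl) v∈ x₁≢v (inj₂ (inj₁ Fv≡nothing))
    solve (_ ∷ _ ∷ _) u fits (inj₂ (inj₂ (v , w , v∈ , w∈ , Fv≢Fw))) =
      withTails u fits v∈ w∈ (λ { refl → Fv≢Fw refl }) (inj₂ (inj₂ Fv≢Fw))

module Construction {n Δ : ℕ} (G : Graph n) (2≤Δ : 2 ≤ Δ) (f : Fin n → Fin Δ)
                    (maxDegree : ∀ u → degree G u ≤ Δ) where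
  open Rows f

  neighbours : Fin n → List (Fin n)
  neighbours y = filter (λ v → adj G y v Bool.≟ true) (allFin n)

  neighbours-unique : ∀ y → Unique (neighbours y)
  neighbours-unique y = filter⁺ (λ v → adj G y v Bool.≟ true) (allFin⁺ n)

  neighbour⁻ : ∀ {y v} → v ∈ neighbours y → Adj G y v
  neighbour⁻ {y} v∈ =
    Equivalence.from T-≡ (proj₂ (∈-filter⁻ (λ v → adj G y v Bool.≟ true) {xs = allFin n} v∈))

  neighbour⁺ : ∀ {y v} → Adj G y v → v ∈ neighbours y
  neighbour⁺ {y} {v} yv = ∈-filter⁺ (λ v → adj G y v Bool.≟ true) (∈-allFin v) (Equivalence.to T-≡ yv)

  adj-sym : ∀ {u v} → Adj G u v → Adj G v u
  adj-sym {u} {v} = subst T (Graph.sym G u v)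

  adj-irrefl : ∀ {u v} → Adj G u v → u ≢ v
  adj-irrefl {u} uu refl = subst T (irrefl G u) uu

  1≤Δ : 1 ≤ Δ
  1≤Δ = ≤-trans (s≤s z≤n) 2≤Δ

  twoNeighbours : ∀ {y} → Δ ≤ length (neighbours y) → ∃₂ λ a b → Adj G y a × Adj G y b × a ≢ b
  twoNeighbours {y} full =
    let a , b , a∈ , b∈ , a≢b = twoDistinct (neighbours-unique y) (≤-trans 2≤Δ full)
    in a , b , neighbour⁻ a∈ , neighbour⁻ b∈ , a≢b

  neighbourOtherThan : ∀ {y} → Δ ≤ length (neighbours y) → ∀ p → ∃ λ v → Adj G y v × v ≢ p
  neighbourOtherThan full p with twoNeighbours full
  ... | a , b , ya , yb , a≢b with a ≟ p
  ...   | yes refl = b , yb , a≢b ∘ sym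
  ...   | no a≢p   = a , ya , a≢p

  -- H u v is the colour of the half-edge e_uv.
  Matrix : Set
  Matrix = Fin n → Fin n → Fin Δ

  RowOK : Matrix → Fin n → Set
  RowOK H u = GoodRow (neighbours u) (H u)

  RowsOK : (Fin n → Set) → Matrix → Set
  RowsOK Q H = ∀ {u} → Q u → RowOK H u

  CrossOK : (Fin n → Set) → (Fin n → Fin n → Set) → Matrix → Set
  CrossOK Q X H = ∀ {u w} → Q u → Q w → Adj G u w → ¬ X u w → H u w ≢ H w u

  crossOK-weaken : ∀ {Q X Y H} → (∀ {u w} → X u w → Y u w) → CrossOK Q X H → CrossOK Q Y H
  crossOK-weaken X⇒Y ok Qu Qw uw ¬Y = ok Qu Qw uw (¬Y ∘ X⇒Y)

  Nowhere : Fin n → Fin n → Set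
  Nowhere _ _ = ⊥

  Touching : Fin n → Fin n → Fin n → Set
  Touching y u w = u ≡ y ⊎ w ≡ y

  Joining : Fin n → (Fin n → Set) → Fin n → Fin n → Set
  Joining y E u w = (u ≡ y × E w) ⊎ (w ≡ y × E u)

  install : ∀ {Q E H y φ} → Q y → (∀ {u} → Q u → u ≢ y → RowOK H u) → CrossOK Q (Touching y) H →
            GoodRow (neighbours y) φ → (∀ {w} → Adj G y w → Q w → ¬ E w → φ w ≢ H w y) →
            RowsOK Q (H [ y ≔ φ ]) × CrossOK Q (Joining y E) (H [ y ≔ φ ])
  install {Q} {E} {H} {y} {φ} Qy rows cross good differs = rows′ , cross′
    where
    H′ = H [ y ≔ φ ]
    row-y : ∀ w → H′ y w ≡ φ w
    row-y = cong-app (≔-same H y φ)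
    row-other : ∀ {u} → u ≢ y → ∀ w → H′ u w ≡ H u w
    row-other u≢y = cong-app (≔-other H φ u≢y)
    rows′ : RowsOK Q H′
    rows′ {u} Qu with u ≟ y
    ... | yes refl = subst (GoodRow (neighbours u)) (sym (≔-same H u φ)) good
    ... | no u≢y   = subst (GoodRow (neighbours u)) (sym (≔-other H φ u≢y)) (rows Qu u≢y)
    cross′ : CrossOK Q (Joining y E) H′
    cross′ {u} {w} Qu Qw uw notJoining with u ≟ y | w ≟ y
    ... | yes refl | yes refl = ⊥-elim (adj-irrefl uw refl)
    ... | yes refl | no w≢y   = λ eq → differs uw Qw (λ Ew → notJoining (inj₁ (refl , Ew)))
                                         (trans (sym (row-y w)) (trans eq (row-other w≢y u)))
    ... | no u≢y   | yes refl = λ eq → differs (adj-sym uw) Qu (λ Eu → notJoining (inj₂ (refl , Eu)))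
                                         (trans (sym (row-y u)) (trans (sym eq) (row-other u≢y w)))
    ... | no u≢y   | no w≢y   = λ eq → cross Qu Qw uw [ u≢y , w≢y ]′
                                         (trans (sym (row-other u≢y w)) (trans eq (row-other w≢y u)))

  -- Vertices are processed in index order; after k steps those of index < k have
  -- good rows and all their edges are properly coloured.
  Processed : ℕ → Fin n → Set
  Processed k u = toℕ u < k

  Valid : ℕ → Matrix → Set
  Valid k H = RowsOK (Processed k) H × CrossOK (Processed k) Nowhere H

  -- The colours that processed neighbours w have put on e_wy, which y must avoid on e_yw.
  demands : ℕ → Matrix → Fin n → Fin n → Maybe (Fin Δ)
  demands k H y w with toℕ w <? k
  ... | yes _ = just (H w y)
  ... | no _  = nothing

  demands-processed : ∀ {k H y w} → Processed k w → demands k H y w ≡ just (H w y)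
  demands-processed {k} {w = w} Pw with toℕ w <? k
  ... | yes _  = refl
  ... | no ¬Pw = ⊥-elim (¬Pw Pw)

  demands-just : ∀ {k H y w c} → demands k H y w ≡ just c → Processed k w × H w y ≡ c
  demands-just {k} {w = w} eq with toℕ w <? k
  ... | yes Pw = Pw , just-injective eq

  respects⇒differs : ∀ {F y φ w a} → Respects F (neighbours y) φ → Adj G y w →
                     F w ≡ just a → φ w ≢ a
  respects⇒differs respects yw Fw φw≡ = respects (neighbour⁺ yw) (trans Fw (cong just (sym φw≡)))

  solveAt : ∀ y F → Unblocked F (neighbours y) → ∃ (Solution F (neighbours y))
  solveAt y F = Solve.solve 2≤Δ F (neighbours y) (neighbours-unique y) (maxDegree y)

  -- Repairing a valid matrix H so that a processed vertex y stops sending c to p.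
  module Repair {k : ℕ} {H : Matrix} (valid : Valid k H) (c : Fin Δ) where

    P : Fin n → Set
    P = Processed k

    demand : Matrix → Fin n → Fin n → Fin n → Maybe (Fin Δ)
    demand H₁ y p = demands k H₁ y [ p ≔ just c ]

    demand-at-p : ∀ H₁ y p → demand H₁ y p p ≡ just c
    demand-at-p H₁ y p = ≔-same (demands k H₁ y) p (just c)

    demand-elsewhere : ∀ H₁ y {p w} → w ≢ p → demand H₁ y p w ≡ demands k H₁ y w
    demand-elsewhere H₁ y = ≔-other (demands k H₁ y) (just c)

    SendsC : Fin n → Set
    SendsC u = ∃ λ x → Adj G u x × P x × H u x ≡ c

    Frame : Matrix → Fin n → Set
    Frame H′ y = ∀ {u} → u ≢ y → H′ u ≗ H u ⊎ SendsC u

    Repaired : Fin n → Fin n → Set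
    Repaired y p = Σ Matrix λ H′ → RowsOK P H′ × CrossOK P (Joining y (_≡ p)) H′ × H′ y p ≢ c × Frame H′ y

    reRow : ∀ {H₁ y p} → P y → Adj G y p → RowsOK P H₁ → CrossOK P (Touching y) H₁ → Frame H₁ y →
            Unblocked (demand H₁ y p) (neighbours y) → Repaired y p
    reRow {H₁} {y} {p} Py yp rows cross frame unblocked = withRow (solveAt y (demand H₁ y p) unblocked)
      where
      withRow : ∃ (Solution (demand H₁ y p) (neighbours y)) → Repaired y p
      withRow (φ , good , respects) = H₁ [ y ≔ φ ] , proj₁ installed , proj₂ installed , avoids-c , frame′
        where
        installed = install {E = _≡ p} Py (λ Qu _ → rows Qu) cross good λ yw Pw w≢p →
                      respects⇒differs respects yw (trans (demand-elsewhere H₁ y w≢p) (demands-processed Pw))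
        avoids-c : (H₁ [ y ≔ φ ]) y p ≢ c
        avoids-c φp≡c = respects⇒differs respects yp (demand-at-p H₁ y p)
                          (trans (sym (cong-app (≔-same H₁ y φ) p)) φp≡c)
        frame′ : Frame (H₁ [ y ≔ φ ]) y
        frame′ u≢y = Sum.map₁ (λ same w → trans (cong-app (≔-other H₁ φ u≢y) w) (same w)) (frame u≢y)

    sender : ∀ {y p} → Adj G y p → Blocked (demand H y p) (neighbours y) →
             ∃ λ v → Adj G y v × v ≢ p × P v × H v y ≡ c
    sender {y} {p} yp (full , c′ , same) =
      let v , yv , v≢p = neighbourOtherThan full p
          c≡c′ = just-injective (trans (sym (demand-at-p H y p)) (All.lookup same (neighbour⁺ yp)))
          Pv , Hvy≡c′ = demands-just (trans (sym (demand-elsewhere H y v≢p)) (All.lookup same (neighbour⁺ yv)))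
      in v , yv , v≢p , Pv , trans Hvy≡c′ (sym c≡c′)

    Linked : List (Fin n) → Set
    Linked L = ∀ {u} → u ∈ L → P u → ∃ λ w → w ∈ L × Adj G u w × H u w ≡ c

    -- A new sender v is not on the chain: a processed member already sends c to
    -- another member, and rows are injective.
    off-chain : ∀ {y p L v} → Unique (y ∷ p ∷ L) → Linked (p ∷ L) → Adj G v y → P v → H v y ≡ c →
                v ∉ y ∷ p ∷ L
    off-chain _ _ vy _ _ (here refl) = adj-irrefl vy refl
    off-chain {y} uniq linked vy Pv Hvy≡c (there v∈) with linked v∈ Pv
    ... | w , w∈ , vw , Hvw≡c with w ≟ y
    ...   | yes refl = head∉tail uniq w∈
    ...   | no w≢y   = proj₁ (proj₁ valid Pv) (neighbour⁺ vw) (neighbour⁺ vy) w≢y (trans Hvw≡c (sym Hvy≡c))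

    -- If y is blocked, first repair at a sender v
    -- towards y; then v and p make different demands on y.  The fuel bounds the
    -- length of the duplicate-free chain by n.
    chain : ∀ fuel {y p L} → P y → Adj G y p → H y p ≡ c → Unique (y ∷ p ∷ L) → Linked (p ∷ L) →
            n ≤ fuel + length (y ∷ p ∷ L) → Repaired y p
    chain fuel {y} {p} {L} Py yp Hyp≡c uniq linked bound with unblocked? 1≤Δ (demand H y p) (neighbours y)
    ... | inj₁ unblocked =
      reRow Py yp (proj₁ valid) (crossOK-weaken {Y = Touching y} (λ ()) (proj₂ valid)) (λ _ → inj₁ λ _ → refl)
            unblocked
    ... | inj₂ blocked with sender yp blocked
    ...   | v , yv , v≢p , Pv , Hvy≡c = continue fuel bound
      where
      uniq′ : Unique (v ∷ y ∷ p ∷ L)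
      uniq′ = ¬Any⇒All¬ _ (off-chain uniq linked (adj-sym yv) Pv Hvy≡c) ∷ uniq
      linked′ : Linked (y ∷ p ∷ L)
      linked′ (here refl) _ = p , there (here refl) , yp , Hyp≡c
      linked′ (there u∈) Pu = let w , w∈ , uw , Huw≡c = linked u∈ Pu in w , there w∈ , uw , Huw≡c
      towards-y : ∀ {u w} → Joining v (_≡ y) u w → Touching y u w
      towards-y (inj₁ (_ , w≡y)) = inj₂ w≡y
      towards-y (inj₂ (_ , u≡y)) = inj₁ u≡y
      frame-extend : ∀ {H₁} → Frame H₁ v → Frame H₁ y
      frame-extend frame₁ {u} u≢y with u ≟ v
      ... | yes refl = inj₂ (y , adj-sym yv , Py , Hvy≡c)
      ... | no u≢v   = frame₁ u≢v
      two-demands : ∀ {H₁} → H₁ v y ≢ c → Unblocked (demand H₁ y p) (neighbours y)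
      two-demands {H₁} H₁vy≢c = inj₂ (inj₂ (v , p , neighbour⁺ yv , neighbour⁺ yp , λ eq →
        H₁vy≢c (just-injective (trans (sym (demands-processed Pv))
                 (trans (sym (demand-elsewhere H₁ y v≢p)) (trans eq (demand-at-p H₁ y p)))))))
      continue : ∀ fuel → n ≤ fuel + length (y ∷ p ∷ L) → Repaired y p
      continue zero bound = ⊥-elim (1+n≰n (≤-trans (unique-length≤ uniq′) bound))
      continue (suc fuel) bound =
        let H₁ , rows₁ , cross₁ , H₁vy≢c , frame₁ =
              chain fuel Pv (adj-sym yv) Hvy≡c uniq′ linked′ (subst (n ≤_) (sym (+-suc fuel _)) bound)
        in reRow Py yp rows₁ (crossOK-weaken towards-y cross₁) (frame-extend frame₁) (two-demands H₁vy≢c)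

    -- A processed vertex z ≠ y that sends c to an unprocessed vertex r still does
    -- so after the repair: by injectivity of its row it sends c to no processed
    -- vertex, so its row is unchanged.
    keeps : ∀ {H′ y z r} → Frame H′ y → z ≢ y → P z → Adj G z r → ¬ P r → H z r ≡ c → H′ z r ≡ c
    keeps {r = r} frame z≢y Pz zr ¬Pr Hzr≡c with frame z≢y
    ... | inj₁ same = trans (same r) Hzr≡c
    ... | inj₂ (x , zx , Px , Hzx≡c) with x ≟ r
    ...   | yes refl = ⊥-elim (¬Pr Px)
    ...   | no x≢r   = ⊥-elim (proj₁ (proj₁ valid Pz) (neighbour⁺ zx) (neighbour⁺ zr) x≢r (trans Hzx≡c (sym Hzr≡c)))

  module Step (k : ℕ) (r : Fin n) (r≡k : toℕ r ≡ k) where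

    r-new : ¬ Processed k r
    r-new r<k = 1+n≰n (subst (_< k) r≡k r<k)

    processed-suc : ∀ {u} → Processed (suc k) u → u ≢ r → Processed k u
    processed-suc u<1+k u≢r with m<1+n⇒m<n∨m≡n u<1+k
    ... | inj₁ u<k = u<k
    ... | inj₂ u≡k = ⊥-elim (u≢r (toℕ-injective (trans u≡k (sym r≡k))))

    addRow : ∀ {H} → Valid k H → Unblocked (demands k H r) (neighbours r) → Σ Matrix (Valid (suc k))
    addRow {H} (rows , cross) unblocked = withRow (solveAt r (demands k H r) unblocked)
      where
      withRow : ∃ (Solution (demands k H r) (neighbours r)) → Σ Matrix (Valid (suc k))
      withRow (φ , good , respects) = H [ r ≔ φ ] , proj₁ installed , crossOK-weaken noException (proj₂ installed)
        where
        crossOld : CrossOK (Processed (suc k)) (Touching r) H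
        crossOld Qu Qw uw notTouching =
          cross (processed-suc Qu (notTouching ∘ inj₁)) (processed-suc Qw (notTouching ∘ inj₂)) uw λ ()
        installed = install {E = λ _ → ⊥} (s≤s (≤-reflexive r≡k)) (λ Qu u≢r → rows (processed-suc Qu u≢r))
                      crossOld good λ rw Qw _ →
                      respects⇒differs respects rw (demands-processed (processed-suc Qw (adj-irrefl rw ∘ sym)))
        noException : ∀ {u w} → Joining r (λ _ → ⊥) u w → Nowhere u w
        noException (inj₁ (_ , ()))
        noException (inj₂ (_ , ()))

    -- If r is blocked, all its neighbours demand one colour c.  Repair at a
    -- neighbour y₀, which then sends a colour ≠ c to r, while a second neighbour
    -- z₀ still sends c; so r becomes unblocked.
    extend : ∀ {H} → Valid k H → Σ Matrix (Valid (suc k))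
    extend {H} valid with unblocked? 1≤Δ (demands k H r) (neighbours r)
    ... | inj₁ unblocked = addRow valid unblocked
    ... | inj₂ (full , c , same) with twoNeighbours full
    ...   | y₀ , z₀ , ry₀ , rz₀ , y₀≢z₀ = repaired (chain n Py₀ (adj-sym ry₀) Hy₀r≡c uniq linked (m≤m+n n _))
      where
      open Repair valid c
      sends : ∀ {w} → Adj G r w → P w × H w r ≡ c
      sends rw = demands-just (All.lookup same (neighbour⁺ rw))
      Py₀ = proj₁ (sends ry₀)
      Hy₀r≡c = proj₂ (sends ry₀)
      uniq : Unique (y₀ ∷ r ∷ [])
      uniq = (adj-irrefl (adj-sym ry₀) ∷ []) ∷ [] ∷ []
      linked : Linked (r ∷ [])
      linked (here refl) Pr = ⊥-elim (r-new Pr)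
      repaired : Repaired y₀ r → Σ Matrix (Valid (suc k))
      repaired (H₁ , rows₁ , cross₁ , H₁y₀r≢c , frame₁) =
        addRow valid₁ (inj₂ (inj₂ (y₀ , z₀ , neighbour⁺ ry₀ , neighbour⁺ rz₀ , differ)))
        where
        valid₁ : Valid k H₁
        valid₁ = rows₁ , λ Pu Pw uw _ →
                   cross₁ Pu Pw uw λ { (inj₁ (_ , refl)) → r-new Pw ; (inj₂ (_ , refl)) → r-new Pu }
        kept : H₁ z₀ r ≡ c
        kept = keeps frame₁ (y₀≢z₀ ∘ sym) (proj₁ (sends rz₀)) (adj-sym rz₀) r-new (proj₂ (sends rz₀))
        differ : demands k H₁ r y₀ ≢ demands k H₁ r z₀
        differ eq = H₁y₀r≢c (just-injective (trans (sym (demands-processed Py₀))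
                      (trans eq (trans (demands-processed (proj₁ (sends rz₀))) (cong just kept)))))

  build : ∀ k → k ≤ n → Σ Matrix (Valid k)
  build zero    _   = (λ _ → f) , (λ ()) , λ ()
  build (suc k) k<n = Step.extend k (fromℕ< k<n) (toℕ-fromℕ< k<n) (proj₂ (build k (<⇒≤ k<n)))

  asHalfEdges : Matrix → HalfEdgeColoring G Δ
  asHalfEdges H u v _ = H u v

  incompatible⇒ : ∀ H {u v} → incompatible? G f (asHalfEdges H) u v ≡ true →
                  v ∈ neighbours u × H u v ≡ f v
  incompatible⇒ H {u} {v} eq with T? (adj G u v)
  incompatible⇒ H {u} {v} () | no _
  ... | yes uv with H u v ≟ f v
  incompatible⇒ H {u} {v} () | yes uv | no _
  ...   | yes Huv≡fv = neighbour⁺ uv , Huv≡fv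

  incompatible≤2 : ∀ H → (∀ u → RowOK H u) → Incompatible G f (asHalfEdges H) 2
  incompatible≤2 H rows u =
    unique-length≤2 (filter⁺ incompatible-at? (allFin⁺ n))
      (All.tabulate (λ v∈ → incompatible⇒ H (proj₂ (∈-filter⁻ incompatible-at? {xs = allFin n} v∈))))
      (proj₂ (rows u))
    where
    incompatible-at? = λ v → incompatible? G f (asHalfEdges H) u v Bool.≟ true

  halfEdgeColouring : Σ (HalfEdgeColoring G Δ) λ h → ProperHalfEdgeColoring G Δ h × Incompatible G f h 2
  halfEdgeColouring =
    let H , rows , cross = build n ≤-refl
    in asHalfEdges H ,
       ((λ u v w uv uw v≢w → proj₁ (rows (toℕ<n u)) (neighbour⁺ uv) (neighbour⁺ uw) v≢w) ,
        (λ u v uv _ → cross (toℕ<n u) (toℕ<n v) uv λ ())) ,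
       incompatible≤2 H (rows ∘ toℕ<n)

-- With a single colour a proper colouring leaves no edge, so every walk is trivial.
oneColour-walk : ∀ {n} {G : Graph n} {f : Fin n → Fin 1} → ProperVertexColoring G 1 f →
                 ∀ {u v} → Walk G u v → u ≡ v
oneColour-walk proper here = refl
oneColour-walk {f = f} proper (step {u} {w} uw _) = ⊥-elim (proper u w uw (single (f u) (f w)))
  where
  single : (a b : Fin 1) → a ≡ b
  single zero zero = refl

lemma5p3 : (n : ℕ) (G : Graph n) (Δ : ℕ) → Connected G → NonComplete G →
    IsMaxDegree G Δ → (f : Fin n → Fin Δ) → ProperVertexColoring G Δ f →
    Σ (HalfEdgeColoring G Δ) (λ h → ProperHalfEdgeColoring G Δ h × Incompatible G f h 2)
lemma5p3 n G zero _ (u , _) _ f _ = ⊥-elim (¬Fin0 (f u))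
lemma5p3 n G (suc zero) connected (u , v , u≢v , _) _ f proper =
  ⊥-elim (u≢v (oneColour-walk proper (connected u v)))
lemma5p3 n G (suc (suc _)) _ _ (maxDegree , _) f _ =
  Construction.halfEdgeColouring G (s≤s (s≤s z≤n)) f maxDegree
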